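{- Let $G$ be an orientable ribbon graph with a fixed orientation, and let $A\subseteq E(G)$. Then the following are equivalent: (i) there exists a choice of orientation of every boundary component of $G-A$ such that for every $e\in A^c$ exactly one of the two edge line segments of $e$ is positive (the other negative), and for every $f\in A$ exactly one of the two common line segments of $f$ is positive (the other negative); (ii) the partial dual $G^{A}$ is checkerboard colourable.
   Context: A ribbon graph is a surface with boundary formed by vertex discs and edge discs, where each edge disc meets vertex discs in exactly two disjoint "common line segments"; removing these from $\partial e$ leaves two "edge line segments" of $e$. For $A\subseteq E(G)$, $G-A$ is obtained by deleting the edge discs in $A$; the edge line segments of edges in $A^c=E(G)\setminus A$ and the common line segments of edges in $A$ lie on boundary components of $G-A$. The fixed orientation of $G$ restricts to $G-A$ and induces an orientation on its boundary; given a chosen orientation of each boundary component of $G-A$, such a segment is called positive if the chosen orientation agrees with the induced one on it, negative otherwise. Faces of a ribbon graph are its boundary components; it is checkerboard colourable if its faces can be coloured red/blue so that for every edge the faces containing its two edge line segments get different colours. The partial dual $G^A$: in the arrow presentation of $G$ (boundary circles of vertex discs with, for each edge $e$, two arrows labelled $e$ on its common line segments, directed consistently with an orientation of $\partial e$), for each $e\in A$ with arrows $\alpha,\beta$ add an arrowed segment from head of $\alpha$ to tail of $\beta$ and one from head of $\beta$ to tail of $\alpha$, label both $e$, delete $\alpha,\beta$ and their underlying arcs; the resulting arrow presentation determines $G^A$. -}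

module Defs where

open import Data.Nat using (ℕ)
open import Data.Fin using (Fin)
open import Data.Bool using (Bool; true; false; not; if_then_else_)
open import Data.Bool.Properties using (not-involutive)
open import Data.Product using (_×_; _,_; proj₁; proj₂; ∃)
open import Data.Sum using (_⊎_)
open import Data.Fin.Subset using (Subset; _∈_; _∉_)
open import Data.Fin.Subset.Properties using (_∈?_)
open import Relation.Nullary using (¬_; yes; no)
open import Relation.Binary.PropositionalEquality using (_≡_; _≢_; refl; cong)
open import Function.Bundles using (_↔_; mk↔ₛ′; Inverse)
open import Function.Construct.Composition using (_↔-∘_)

-- Each edge e has two ends ("darts")
-- (e , false) and (e , true); dart d corresponds to the common line
-- segment C_d of e on a vertex disc (i.e. to one arrow labelled e in the
-- arrow presentation).

Dart : ℕ → Set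
Dart m = Fin m × Bool

edge : ∀ {m} → Dart m → Fin m
edge = proj₁

opp : ∀ {m} → Dart m → Dart m
opp d = proj₁ d , not (proj₂ d)

opp-involutive : ∀ {m} (d : Dart m) → opp (opp d) ≡ d
opp-involutive (e , b) = cong (e ,_) (not-involutive b)

-- An orientable ribbon graph with a fixed orientation: the vertex discs
-- are oriented by the fixed orientation; σ sends a dart d to the next
-- dart met when travelling around the boundary of the vertex disc of d
-- in the direction of the induced orientation.  Vertices = σ-orbits.
-- The vertex arc ("corner") running from the common line segment C_d to
-- C_(σ d) is named by the dart d.

record OrientedRibbonGraph : Set where
  field
    nEdges : ℕ
    σ      : Dart nEdges ↔ Dart nEdges

open OrientedRibbonGraph public

E : OrientedRibbonGraph → Set
E G = Fin (nEdges G)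

D : OrientedRibbonGraph → Set
D G = Dart (nEdges G)

rot : (G : OrientedRibbonGraph) → D G → D G
rot G = Inverse.to (σ G)

-- Travelling along a boundary component of G - A in the direction of the
-- orientation induced from G, after the corner d one reaches the common
-- line segment C_y with y = σ d.  If edge y ∈ A (deleted) one runs along
-- C_y and continues with corner y; otherwise one runs along the edge line
-- segment L_y of edge y (from the end of e at y to the other end opp y)
-- and continues with corner (opp y).

boundaryNext : (G : OrientedRibbonGraph) → Subset (nEdges G) → D G → D G
boundaryNext G A d with edge (rot G d) ∈? A
... | yes _ = rot G d
... | no  _ = opp (rot G d)

data Segment (m : ℕ) : Set where
  edgeLine   : Dart m → Segment m   -- L_d : edge line segment leaving C_d
  commonLine : Dart m → Segment m   -- C_d : common line segment of dart d

-- The boundary component of G - A containing a segment is identified by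
-- the corner that follows the segment in the induced orientation.
followingCorner : ∀ {m} → Segment m → Dart m
followingCorner (edgeLine d)   = opp d
followingCorner (commonLine d) = d

-- A choice of orientation of every boundary component of G - A:
-- true = agrees with the induced orientation, false = opposite.
-- It is a function on corners, constant along boundary components.
BoundaryOrientation : (G : OrientedRibbonGraph) → Subset (nEdges G) → Set
BoundaryOrientation G A =
  ∃ λ (o : D G → Bool) → ∀ d → o (boundaryNext G A d) ≡ o d

-- A segment (lying on the boundary of G - A) is positive iff the chosen
-- orientation of its boundary component agrees with the induced one on
-- it (the induced orientation of the component restricts to the induced
-- orientation of the segment).
Positive : (G : OrientedRibbonGraph) (A : Subset (nEdges G)) →
           BoundaryOrientation G A → Segment (nEdges G) → Set
Positive G A (o , _) s = o (followingCorner s) ≡ true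

Negative : (G : OrientedRibbonGraph) (A : Subset (nEdges G)) →
           BoundaryOrientation G A → Segment (nEdges G) → Set
Negative G A O s = ¬ Positive G A O s

ExactlyOnePositive : (G : OrientedRibbonGraph) (A : Subset (nEdges G)) →
                     BoundaryOrientation G A →
                     Segment (nEdges G) → Segment (nEdges G) → Set
ExactlyOnePositive G A O s t =
  (Positive G A O s × Negative G A O t) ⊎ (Negative G A O s × Positive G A O t)

-- Faces and checkerboard colourings.  Faces = boundary components of
-- G = G - ∅; the two edge line segments of e are L_(e,false), L_(e,true).

faceOf : (G : OrientedRibbonGraph) → Segment (nEdges G) → D G
faceOf G = followingCorner

CheckerboardColourable : OrientedRibbonGraph → Set
CheckerboardColourable G =
  ∃ λ (c : D G → Bool) →
    (∀ d → c (boundaryNext G Data.Fin.Subset.⊥ d) ≡ c d) ×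
    (∀ (e : E G) → c (faceOf G (edgeLine (e , false)))
                 ≢ c (faceOf G (edgeLine (e , true))))
  where import Data.Fin.Subset

-- In the arrow presentation of G take the arrow of dart d from the start
-- s_d to the end t_d of C_d (this is consistent with an orientation of
-- ∂e, since the orientation of ∂e induced from G runs along both C_d and
-- C_(opp d) in the direction opposite to the vertex orientations; any
-- consistent choice gives the same ribbon graph).  For e ∈ A, the new
-- arrowed segments join t_d to s_(opp d) and t_(opp d) to s_d, and the
-- arcs C_d, C_(opp d) are removed.  Following the resulting circles
-- forward along the remaining vertex arcs, the corner after corner x is
-- σ x if edge (σ x) ∉ A and opp (σ x) if edge (σ x) ∈ A (the new segment
-- being traversed against its arrow; reversing both arrows of e gives an
-- equivalent presentation).  Naming each arrow of the new presentation by
-- the corner that follows it, G^A has the same edges, the same ends, and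
-- rotation  σ^A = τ_A ∘ σ,  with τ_A y = opp y if edge y ∈ A, else y.

τ : ∀ {m} → Subset m → Dart m → Dart m
τ A y with edge y ∈? A
... | yes _ = opp y
... | no  _ = y

τ-involutive : ∀ {m} (A : Subset m) (y : Dart m) → τ A (τ A y) ≡ y
τ-involutive A y with edge y ∈? A
... | yes p with edge (opp y) ∈? A
...   | yes _ = opp-involutive y
...   | no ¬p = Data.Empty.⊥-elim (¬p p)
  where import Data.Empty
τ-involutive A y | no ¬p with edge y ∈? A
...   | yes p = Data.Empty.⊥-elim (¬p p)
  where import Data.Empty
...   | no _ = refl

τ↔ : ∀ {m} → Subset m → Dart m ↔ Dart m
τ↔ A = mk↔ₛ′ (τ A) (τ A) (τ-involutive A) (τ-involutive A)

partialDual : (G : OrientedRibbonGraph) → Subset (nEdges G) → OrientedRibbonGraph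
partialDual G A = record
  { nEdges = nEdges G
  ; σ      = τ↔ A ↔-∘ σ G
  }

{-# OPTIONS --safe #-}
module Submission where

open import Defs
open import Data.Bool using (Bool; false; true)
open import Data.Empty using (⊥-elim)
open import Data.Fin.Subset using (Subset; _∈_; _∉_; ⊥)
open import Data.Fin.Subset.Properties using (_∈?_; ∉⊥)
open import Data.Product using (_×_; _,_; ∃; proj₁)
open import Data.Product.Function.Dependent.Propositional using (congˡ)
open import Data.Sum using (_⊎_; inj₁; inj₂)
open import Function using (_∘_)
open import Function.Bundles using (_⇔_; mk⇔; Equivalence)
open import Function.Construct.Composition using (_⇔-∘_)
open import Relation.Nullary using (¬_; yes; no)
open import Relation.Binary.PropositionalEquality
  using (_≡_; _≢_; _≗_; refl; sym; trans; cong; ≢-sym)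

-- The faces of G^A are the boundary components of G - A: σ^A = τ_A ∘ σ
-- makes the face walk of G^A cross each edge of A along its common line
-- segments instead of its edge line segments.  Both positivity conditions
-- of (i) then say that the two ends of every edge lie on components with
-- different chosen orientations, i.e. the chosen orientations are exactly
-- a checkerboard colouring of the faces of G^A.

exactlyOneTrue⇔≢ : (x y : Bool) →
  ((x ≡ true × ¬ y ≡ true) ⊎ (¬ x ≡ true × y ≡ true)) ⇔ x ≢ y
exactlyOneTrue⇔≢ x y = mk⇔ to (from x y)
  where
  to : (x ≡ true × ¬ y ≡ true) ⊎ (¬ x ≡ true × y ≡ true) → x ≢ y
  to (inj₁ (x≡true , y≢true)) x≡y = y≢true (trans (sym x≡y) x≡true)
  to (inj₂ (x≢true , y≡true)) x≡y = x≢true (trans x≡y y≡true)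

  from : (x y : Bool) → x ≢ y → (x ≡ true × ¬ y ≡ true) ⊎ (¬ x ≡ true × y ≡ true)
  from true  true  x≢y = ⊥-elim (x≢y refl)
  from true  false _   = inj₁ (refl , λ ())
  from false true  _   = inj₂ ((λ ()) , refl)
  from false false x≢y = ⊥-elim (x≢y refl)

boundaryNext-partialDual : (G : OrientedRibbonGraph) (A : Subset (nEdges G)) →
  boundaryNext (partialDual G A) ⊥ ≗ boundaryNext G A
boundaryNext-partialDual G A d with edge (τ A (rot G d)) ∈? ⊥
... | yes e∈⊥ = ⊥-elim (∉⊥ e∈⊥)
... | no _ with edge (rot G d) ∈? A
...   | yes _ = opp-involutive (rot G d)
...   | no  _ = refl

EndsSeparated : ∀ {m} → (Dart m → Bool) → Set
EndsSeparated c = ∀ e → c (e , false) ≢ c (e , true)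

PositivityConditions : (G : OrientedRibbonGraph) (A : Subset (nEdges G)) →
  BoundaryOrientation G A → Set
PositivityConditions G A O =
  (∀ (e : E G) → e ∉ A →
     ExactlyOnePositive G A O (edgeLine (e , false)) (edgeLine (e , true)))
  × (∀ (f : E G) → f ∈ A →
     ExactlyOnePositive G A O (commonLine (f , false)) (commonLine (f , true)))

positivityConditions⇔endsSeparated :
  (G : OrientedRibbonGraph) (A : Subset (nEdges G)) (O : BoundaryOrientation G A) →
  PositivityConditions G A O ⇔ EndsSeparated (proj₁ O)
positivityConditions⇔endsSeparated G A O@(o , _) = mk⇔ to from
  where
  exactlyOne⇔≢ : ∀ s t →
    ExactlyOnePositive G A O s t ⇔ o (followingCorner s) ≢ o (followingCorner t)
  exactlyOne⇔≢ s t = exactlyOneTrue⇔≢ (o (followingCorner s)) (o (followingCorner t))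

  edgeLines⇔ : ∀ e → ExactlyOnePositive G A O (edgeLine (e , false)) (edgeLine (e , true))
                     ⇔ o (e , true) ≢ o (e , false)
  edgeLines⇔ e = exactlyOne⇔≢ (edgeLine (e , false)) (edgeLine (e , true))

  commonLines⇔ : ∀ f → ExactlyOnePositive G A O (commonLine (f , false)) (commonLine (f , true))
                       ⇔ o (f , false) ≢ o (f , true)
  commonLines⇔ f = exactlyOne⇔≢ (commonLine (f , false)) (commonLine (f , true))

  to : PositivityConditions G A O → EndsSeparated o
  to (edgeLines , commonLines) e with e ∈? A
  ... | yes e∈A = Equivalence.to (commonLines⇔ e) (commonLines e e∈A)
  ... | no  e∉A = ≢-sym (Equivalence.to (edgeLines⇔ e) (edgeLines e e∉A))

  from : EndsSeparated o → PositivityConditions G A O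
  from separated =
      (λ e _ → Equivalence.from (edgeLines⇔ e) (≢-sym (separated e)))
    , (λ f _ → Equivalence.from (commonLines⇔ f) (separated f))

SeparatingOrientation : (G : OrientedRibbonGraph) → Subset (nEdges G) → Set
SeparatingOrientation G A =
  ∃ λ (O : BoundaryOrientation G A) → EndsSeparated (proj₁ O)

separatingOrientation⇔checkerboardColourable-partialDual :
  (G : OrientedRibbonGraph) (A : Subset (nEdges G)) →
  SeparatingOrientation G A ⇔ CheckerboardColourable (partialDual G A)
separatingOrientation⇔checkerboardColourable-partialDual G A = mk⇔ to from
  where
  transport : ∀ {f g : D G → D G} (c : D G → Bool) → f ≗ g →
    (∀ d → c (f d) ≡ c d) → ∀ d → c (g d) ≡ c d
  transport c f≗g invariant d = trans (cong c (sym (f≗g d))) (invariant d)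

  to : SeparatingOrientation G A → CheckerboardColourable (partialDual G A)
  to ((c , invariant) , separated) =
    c , transport c (sym ∘ boundaryNext-partialDual G A) invariant , ≢-sym ∘ separated

  from : CheckerboardColourable (partialDual G A) → SeparatingOrientation G A
  from (c , invariant , colouring) =
    (c , transport c (boundaryNext-partialDual G A) invariant) , ≢-sym ∘ colouring

lemma1 : (G : OrientedRibbonGraph) (A : Subset (nEdges G)) →
    (∃ λ (O : BoundaryOrientation G A) →
        (∀ (e : E G) → e ∉ A →
           ExactlyOnePositive G A O (edgeLine (e , false)) (edgeLine (e , true)))
      × (∀ (f : E G) → f ∈ A →
           ExactlyOnePositive G A O (commonLine (f , false)) (commonLine (f , true))))
    ⇔ CheckerboardColourable (partialDual G A)
lemma1 G A =
  separatingOrientation⇔checkerboardColourable-partialDual G A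
  ⇔-∘ congˡ (λ {O} → positivityConditions⇔endsSeparated G A O)
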